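{- Let $\overline{\mathsf{M}}$ be a complemented HMS model. For any individual $i\in I$ and any event $E\in\Sigma$: (1) $K_i(E)=L_i(E)\cap A_i(E)$; (2) $U_i(E)=L_i(U_i(E))$; (3) $A_i(E)=L_i(A_i(E))$; (4) $A_iL_i(E)=A_i(E)$.
   Context: Fix a non-empty set $\mathsf{At}$. A complemented HMS model $\langle I,\{S_\Phi\}_{\Phi\subseteq\mathsf{At}},(r^\Phi_\Psi),(\Lambda_i)_{i\in I},(\Pi_i)_{i\in I},v\rangle$: $I\neq\emptyset$; non-empty pairwise disjoint spaces $S_\Phi$, ordered $S_{\Phi'}\succeq S_\Phi$ iff $\Phi\subseteq\Phi'$; $\Omega=\bigcup_\Phi S_\Phi$; surjections $r^\Phi_\Psi:S_\Phi\to S_\Psi$ ($\Psi\subseteq\Phi$), $r^\Phi_\Phi=\mathrm{id}$, $r^\Phi_\Upsilon=r^\Psi_\Upsilon\circ r^\Phi_\Psi$; $\omega_\Psi=r^\Phi_\Psi(\omega)$, $D_\Psi=D_{S_\Psi}=r^\Phi_\Psi(D)$, $D^\uparrow=\bigcup_{\Phi\subseteq\Psi}(r^\Psi_\Phi)^{ -1}(D)$ for $D\subseteq S_\Phi$. Events: $E=D^\uparrow$, $D\subseteq S_\Phi$, base-space $S(E)=S_\Phi$, base $D$ (vacuous events $\emptyset^{S_\Phi}$ distinguished by base-space); $\Sigma$ = set of events; $\neg E=(S(E)\setminus D)^\uparrow$; conjunction = intersection. $\Pi_i:\Omega\to2^\Omega\setminus\{\emptyset\}$: Confinement ($\omega\in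 S_\Phi\Rightarrow\Pi_i(\omega)\subseteq S_\Psi$ for some $\Psi\subseteq\Phi$, denoted $S_{\Pi_i(\omega)}$), Generalized Reflexivity ($\omega\in\Pi_i(\omega)^\uparrow$), Stationarity ($\omega'\in\Pi_i(\omega)\Rightarrow\Pi_i(\omega')=\Pi_i(\omega)$), Projections Preserve Ignorance ($\omega\in S_\Phi$, $\Psi\subseteq\Phi\Rightarrow\Pi_i(\omega)^\uparrow\subseteq\Pi_i(\omega_\Psi)^\uparrow$), Projections Preserve Knowledge ($\Upsilon\subseteq\Psi\subseteq\Phi$, $\omega\in S_\Phi$, $\Pi_i(\omega)\subseteq S_\Psi\Rightarrow\Pi_i(\omega)_\Upsilon=\Pi_i(\omega_\Upsilon)$). $\Lambda_i:\Omega\to2^\Omega$: Reflexivity ($\omega\in\Lambda_i(\omega)$), Stationarity, Projections Preserve Implicit Knowledge ($\omega\in S_\Phi$, $\Psi\subseteq\Phi\Rightarrow\Lambda_i(\omega)_\Psi=\Lambda_i(\omega_\Psi)$), Explicit Measurability ($\omega'\in\Lambda_i(\omega)\Rightarrow\Pi_i(\omega')=\Pi_i(\omega)$), Implicit Measurability ($\omega'\in\Pi_i(\omega)\Rightarrow\Lambda_i(\omega')=\Lambda_i(\omega)_{S_{\Pi_i(\omega)}}$). $v$: valuation of atoms by events. Operators: $K_i(E)=\{\omega:\Pi_i(\omega)\subseteq E\}$ if non-empty, else $\emptyset^{S(E)}$; $A_i(E)=\{\omega:S_{\Pi_i(\omega)}\succeq S(E)\}$ if non-empty, else $\emptyset^{S(E)}$;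 $U_i(E)=\neg A_i(E)$; $L_i(E)=\{\omega:\Lambda_i(\omega)\subseteq E\}$ if non-empty, else $\emptyset^{S(E)}$. -}

module Defs where

open import Level using (0ℓ; suc; Lift)
open import Data.Product using (Σ; ∃; _×_; _,_; proj₁; proj₂)
open import Relation.Binary.PropositionalEquality using (_≡_)
open import Relation.Nullary using (¬_)
open import Relation.Unary using (Pred; _⊆_; _∪_; _∩_)

Sub : Set → Set₁
Sub At = Pred At 0ℓ

-- A complemented HMS model over the (non-empty) set of atoms At.
-- The state space is Ω = Σ Φ, S Φ, so the spaces S_Φ are automatically
-- pairwise disjoint; ω = (Φ , x) means ω ∈ S_Φ.
record HMS (At : Set) : Set₂ where
  field
    I      : Set
    someI  : I
    S      : Sub At → Set
    S-ne   : (Φ : Sub At) → S Φ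
    r      : ∀ {Φ Ψ : Sub At} → .(Ψ ⊆ Φ) → S Φ → S Ψ
    r-surj : ∀ {Φ Ψ : Sub At} .(p : Ψ ⊆ Φ) (y : S Ψ) → ∃ λ x → r p x ≡ y
    r-id   : ∀ {Φ : Sub At} (x : S Φ) → r {Φ} {Φ} (λ z → z) x ≡ x
    r-comp : ∀ {Φ Ψ Υ : Sub At} .(p : Ψ ⊆ Φ) .(q : Υ ⊆ Ψ) (x : S Φ) →
             r {Φ} {Υ} (λ z → p (q z)) x ≡ r q (r p x)
  Ω : Set₁
  Ω = Σ (Sub At) S
  up : Pred Ω (suc 0ℓ) → Pred Ω (suc 0ℓ)
  up X (Φ' , x') = Σ Ω λ ω → X ω × Σ (proj₁ ω ⊆ Φ') λ p → r p x' ≡ proj₂ ω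
  proj : Sub At → Pred Ω (suc 0ℓ) → Pred Ω (suc 0ℓ)
  proj Υ X ω' = Σ Ω λ ω → X ω × Σ (Υ ⊆ proj₁ ω) λ p → ω' ≡ (Υ , r p (proj₂ ω))
  _≐_ : Pred Ω (suc 0ℓ) → Pred Ω (suc 0ℓ) → Set₁
  X ≐ Y = (X ⊆ Y) × (Y ⊆ X)
  field
    -- possibility correspondences Π_i; πsp i ω is the space S_{Π_i(ω)}
    Π          : I → Ω → Pred Ω (suc 0ℓ)
    πsp        : I → Ω → Sub At
    Π-ne       : ∀ i ω → ∃ λ ω' → Π i ω ω'
    Π-conf     : ∀ i ω ω' → Π i ω ω' → proj₁ ω' ≡ πsp i ω
    πsp-below  : ∀ i ω → πsp i ω ⊆ proj₁ ω
    Π-genrefl  : ∀ i ω → up (Π i ω) ω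
    Π-stat     : ∀ i ω ω' → Π i ω ω' → Π i ω' ≐ Π i ω
    Π-PPI      : ∀ i Φ (x : S Φ) Ψ (p : Ψ ⊆ Φ) →
                 up (Π i (Φ , x)) ⊆ up (Π i (Ψ , r p x))
    Π-PPK      : ∀ i Φ (x : S Φ) Υ (q : Υ ⊆ πsp i (Φ , x)) →
                 proj Υ (Π i (Φ , x)) ≐ Π i (Υ , r (λ z → πsp-below i (Φ , x) (q z)) x)
    Λ          : I → Ω → Pred Ω (suc 0ℓ)
    Λ-conf     : ∀ i ω ω' → Λ i ω ω' → proj₁ ω' ≡ proj₁ ω
    Λ-refl     : ∀ i ω → Λ i ω ω
    Λ-stat     : ∀ i ω ω' → Λ i ω ω' → Λ i ω' ≐ Λ i ω
    Λ-PPIK     : ∀ i Φ (x : S Φ) Ψ (p : Ψ ⊆ Φ) →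
                 proj Ψ (Λ i (Φ , x)) ≐ Λ i (Ψ , r p x)
    explMeas   : ∀ i ω ω' → Λ i ω ω' → Π i ω' ≐ Π i ω
    implMeas   : ∀ i ω ω' → Π i ω ω' → Λ i ω' ≐ proj (πsp i ω) (Λ i ω)
    v          : At → Σ (Sub At) λ Φ → Pred (S Φ) 0ℓ

module Ops {At : Set} (M : HMS At) where
  open HMS M

  -- An event E ∈ Σ, given by its base-space S_Φ and base D ⊆ S_Φ.
  Event : Set₁
  Event = Σ (Sub At) λ Φ → Pred (S Φ) 0ℓ

  record Ev : Set₂ where
    constructor ⟨_,_⟩
    field
      sp  : Sub At
      set : Pred Ω (suc 0ℓ)
  open Ev public

  upD : ∀ {ℓ} (Φ : Sub At) → Pred (S Φ) ℓ → Pred Ω ℓ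
  upD Φ D (Φ' , x') = Σ (Φ ⊆ Φ') λ p → D (r p x')

  ⌜_⌝ : Event → Ev
  ⌜ (Φ , D) ⌝ = ⟨ Φ , (λ ω → Lift (suc 0ℓ) (upD Φ D ω)) ⟩

  ∼_ : Ev → Ev
  ∼ E = ⟨ sp E , upD (sp E) (λ x → ¬ set E (sp E , x)) ⟩

  _⊓_ : Ev → Ev → Ev
  E ⊓ F = ⟨ sp E ∪ sp F , set E ∩ set F ⟩

  _≋_ : Ev → Ev → Set₁
  E ≋ F = ((sp E ⊆ sp F) × (sp F ⊆ sp E)) × (set E ≐ set F)

  -- Operators (when the defining set is empty it is the vacuous event
  -- ∅^{S(E)}; the base-space is S(E) in every case).
  K : I → Ev → Ev
  K i E = ⟨ sp E , (λ ω → Π i ω ⊆ set E) ⟩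

  A : I → Ev → Ev
  A i E = ⟨ sp E , (λ ω → Lift (suc 0ℓ) (sp E ⊆ πsp i ω)) ⟩

  U : I → Ev → Ev
  U i E = ∼ (A i E)

  L : I → Ev → Ev
  L i E = ⟨ sp E , (λ ω → Λ i ω ⊆ set E) ⟩

-- States in Λ_i(ω) share ω's explicit possibility set (explicit measurability,
-- and for U_i also after projecting to the base-space), hence its awareness
-- space; so A_i(E) and U_i(E) are closed under Λ_i and therefore fixed by L_i.
-- For K_i = L_i ∩ A_i: by implicit measurability Π_i(ω) is the projection of
-- Λ_i(ω) onto the awareness space, which contains the base-space of E when
-- i is aware of E, and events D^↑ are closed both upwards and under
-- projection onto spaces still containing their base-space.
module Submission where

open import Defs
open import Data.Product using (_×_; _,_; proj₁; proj₂)
open import Data.Sum using (inj₁; [_,_])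
open import Function using (id)
open import Level using (0ℓ; suc; lift; lower)
open import Relation.Unary using (Pred; _⊆_)
open import Relation.Binary.PropositionalEquality using (_≡_; refl; sym; trans; subst)

module _ {At : Set} (M : HMS At) where
  open HMS M
  open Ops M

  upD-upward : ∀ {ℓ Φ Ψ Ψ'} {D : Pred (S Φ) ℓ} (p : Ψ ⊆ Ψ') (x : S Ψ') →
               upD Φ D (Ψ , r p x) → upD Φ D (Ψ' , x)
  upD-upward {D = D} p x (q , d) = (λ z → p (q z)) , subst D (sym (r-comp p q x)) d

  upD-project : ∀ {ℓ Φ Ψ Ψ'} {D : Pred (S Φ) ℓ} (p : Ψ ⊆ Ψ') (x : S Ψ') → Φ ⊆ Ψ →
                upD Φ D (Ψ' , x) → upD Φ D (Ψ , r p x)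
  upD-project {D = D} p x Φ⊆Ψ (q , d) = Φ⊆Ψ , subst D (r-comp p Φ⊆Ψ x) d

  ≋-refl : ∀ {F} → F ≋ F
  ≋-refl = (id , id) , (id , id)

  Λ-Closed : I → Pred Ω (suc 0ℓ) → Set₁
  Λ-Closed i X = ∀ {ω ω'} → Λ i ω ω' → X ω → X ω'

  L-deflationary : ∀ i F → set (L i F) ⊆ set F
  L-deflationary i F {ω} h = h (Λ-refl i ω)

  L-fixes-Λ-closed : ∀ i F → Λ-Closed i (set F) → F ≋ L i F
  L-fixes-Λ-closed i F closed = (id , id) , ((λ h l → closed l h) , L-deflationary i F)

  πsp-resp-Π : ∀ i {ω ω'} → Π i ω ⊆ Π i ω' → πsp i ω ≡ πsp i ω'
  πsp-resp-Π i {ω} {ω'} Πω⊆Πω' with Π-ne i ω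
  ... | ω₀ , m = trans (sym (Π-conf i ω ω₀ m)) (Π-conf i ω' ω₀ (Πω⊆Πω' m))

  πsp-Λ-invariant : ∀ i {ω ω'} → Λ i ω ω' → πsp i ω' ≡ πsp i ω
  πsp-Λ-invariant i {ω} {ω'} l = πsp-resp-Π i (proj₁ (explMeas i ω ω' l))

  Λ-project : ∀ i {Ψ Φ} {x x' : S Ψ} (p : Φ ⊆ Ψ) →
              Λ i (Ψ , x) (Ψ , x') → Λ i (Φ , r p x) (Φ , r p x')
  Λ-project i {Ψ} {x = x} {x'} p l = proj₁ (Λ-PPIK i Ψ x _ p) ((Ψ , x') , l , p , refl)

  A-Λ-closed : ∀ i F → Λ-Closed i (set (A i F))
  A-Λ-closed i F l (lift aware) = lift (subst (sp F ⊆_) (sym (πsp-Λ-invariant i l)) aware)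

  U-Λ-closed : ∀ i F → Λ-Closed i (set (U i F))
  U-Λ-closed i F {Ψ , x} {Ψ' , x'} l (p , unaware) with Λ-conf i (Ψ , x) (Ψ' , x') l
  ... | refl = p , λ (lift aware) →
    unaware (lift (subst (sp F ⊆_) (πsp-Λ-invariant i (Λ-project i p l)) aware))

  module _ (i : I) (E : Event) where
    private
      Φ = proj₁ E
      D = proj₂ E

    K⊆A : set (K i ⌜ E ⌝) ⊆ set (A i ⌜ E ⌝)
    K⊆A {ω} known with Π-ne i ω
    ... | ω₀ , m = lift (subst (Φ ⊆_) (Π-conf i ω ω₀ m) (proj₁ (lower (known m))))

    -- ω' lies above some state of Π_i(ω'), and that state is in Π_i(ω).
    K⊆L : set (K i ⌜ E ⌝) ⊆ set (L i ⌜ E ⌝)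
    K⊆L {ω} known {Ψ , x} l with Π-genrefl i (Ψ , x)
    ... | ω₀ , m , p , refl =
      lift (upD-upward {D = D} p x (lower (known (proj₁ (explMeas i ω (Ψ , x) l) m))))

    L∩A⊆K : set (L i ⌜ E ⌝ ⊓ A i ⌜ E ⌝) ⊆ set (K i ⌜ E ⌝)
    L∩A⊆K {ω} (implicit , lift aware) {ω'} m
      with proj₁ (implMeas i ω ω' m) (Λ-refl i ω')
    ... | (_ , x) , l , p , refl = lift (upD-project {D = D} p x aware (lower (implicit l)))

    K≋L⊓A : K i ⌜ E ⌝ ≋ (L i ⌜ E ⌝ ⊓ A i ⌜ E ⌝)
    K≋L⊓A = (inj₁ , [ id , id ]) ,
            ((λ known → K⊆L known , K⊆A known) , L∩A⊆K)

proposition4 : {At : Set} → At → (M : HMS At) → (i : HMS.I M) → (E : Ops.Event M) →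
    (Ops._≋_ M (Ops.K M i (Ops.⌜_⌝ M E)) (Ops._⊓_ M (Ops.L M i (Ops.⌜_⌝ M E)) (Ops.A M i (Ops.⌜_⌝ M E))))
    × (Ops._≋_ M (Ops.U M i (Ops.⌜_⌝ M E)) (Ops.L M i (Ops.U M i (Ops.⌜_⌝ M E))))
    × (Ops._≋_ M (Ops.A M i (Ops.⌜_⌝ M E)) (Ops.L M i (Ops.A M i (Ops.⌜_⌝ M E))))
    × (Ops._≋_ M (Ops.A M i (Ops.L M i (Ops.⌜_⌝ M E))) (Ops.A M i (Ops.⌜_⌝ M E)))
proposition4 _ M i E =
    K≋L⊓A M i E
  , L-fixes-Λ-closed M i (U i ⌜ E ⌝) (U-Λ-closed M i ⌜ E ⌝)
  , L-fixes-Λ-closed M i (A i ⌜ E ⌝) (A-Λ-closed M i ⌜ E ⌝)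
    -- A_i only sees the base-space, which L_i leaves unchanged.
  , ≋-refl M
  where open Ops M
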